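{- Let $\mathcal A$ be an associative unital $\mathbb C$-algebra, $A,B\in\mathcal A$, and $\alpha,\lambda\in\mathbb C$ both nonzero. Let $s$ be a square root of $\lambda\alpha$, written $\sqrt{\lambda\alpha}$, and write $\sqrt{\lambda/\alpha}:=s/\alpha$. Then the following are equivalent: (i) $[B,A]=\alpha-\lambda A^2$; (ii) for all $t$, $e^{(A+B)t}=\left(\cosh(\sqrt{\lambda\alpha}\,t)+A\sqrt{\tfrac{\lambda}{\alpha}}\sinh(\sqrt{\lambda\alpha}\,t)\right)^{1/\lambda}e^{Bt}$.
   Context: Scalars are identified with their multiples of $1_{\mathcal A}$; $[X,Y]=XY-YX$; $e^X=\sum_{n\ge0}X^n/n!$. For $X$ (formal series in $t$ with coefficients in $\mathcal A$) and a scalar $\mu$, $X^\mu:=\sum_{k\ge0}(X-1)^k\binom{\mu}{k}$, $\binom{\mu}{k}=\mu(\mu-1)\cdots(\mu-k+1)/k!$. Series are treated formally; identities in $t$ are equalities of formal power series in $t$. -}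

module Defs where

open import Level using (Level; _⊔_) renaming (suc to lsuc)
open import Data.Nat using (ℕ; zero; suc; _∸_)
open import Relation.Nullary using (¬_)
open import Algebra.Bundles using (CommutativeRing; Ring)
open import Algebra.Morphism.Structures using (IsRingHomomorphism)

module _ {c ℓ} (R : CommutativeRing c ℓ) where
  open CommutativeRing R
  natR : ℕ → Carrier
  natR zero    = 0#
  natR (suc n) = 1# + natR n

-- A field of characteristic zero (stand-in for ℂ)

record CharZeroField (c ℓ : Level) : Set (lsuc (c ⊔ ℓ)) where
  field
    cring : CommutativeRing c ℓ
  open CommutativeRing cring public hiding (zero)
  field
    inv      : (x : Carrier) → ¬ (x ≈ 0#) → Carrier
    inv-r    : ∀ x (p : ¬ (x ≈ 0#)) → x * inv x p ≈ 1#
    charZero : ∀ n → ¬ (natR cring (suc n) ≈ 0#)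

-- Associative unital K-algebra: a ring with a central ring homomorphism
-- K → 𝒜 (scalars k identified with k·1 = ι k).

record KAlgebra {c ℓ} (K : CharZeroField c ℓ) (a ℓa : Level)
       : Set (lsuc (a ⊔ ℓa) ⊔ c ⊔ ℓ) where
  private module K = CharZeroField K
  field
    ring    : Ring a ℓa
  open Ring ring public hiding (zero)
  field
    ι         : K.Carrier → Carrier
    ι-hom     : IsRingHomomorphism (CommutativeRing.rawRing K.cring) rawRing ι
    ι-central : ∀ k x → ι k * x ≈ x * ι k

module FieldOps {c ℓ} (K : CharZeroField c ℓ) where
  open CharZeroField K

  recipSuc : ℕ → Carrier
  recipSuc n = inv (natR cring (suc n)) (charZero n)

  invFact : ℕ → Carrier
  invFact zero    = 1#
  invFact (suc n) = invFact n * recipSuc n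

  powK : Carrier → ℕ → Carrier
  powK x zero    = 1#
  powK x (suc n) = x * powK x n

  falling : Carrier → ℕ → Carrier
  falling μ zero    = 1#
  falling μ (suc k) = falling μ k * (μ - natR cring k)

  binom : Carrier → ℕ → Carrier
  binom μ k = falling μ k * invFact k

  -- Taylor coefficients (in t) of cosh(s t) and sinh(s t):
  -- cosh(st) = (e^{st}+e^{-st})/2 , sinh(st) = (e^{st}-e^{-st})/2
  half : Carrier
  half = recipSuc 1

  coshC : Carrier → ℕ → Carrier
  coshC s n = half * ((powK s n + powK (- s) n) * invFact n)

  sinhC : Carrier → ℕ → Carrier
  sinhC s n = half * ((powK s n - powK (- s) n) * invFact n)

-- Formal power series in t with coefficients in 𝒜

module Series {c ℓ a ℓa} {K : CharZeroField c ℓ} (𝒜 : KAlgebra K a ℓa) where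
  open KAlgebra 𝒜
  open FieldOps K using (invFact; binom)

  PS : Set a
  PS = ℕ → Carrier

  _≈PS_ : PS → PS → Set ℓa
  f ≈PS g = ∀ n → f n ≈ g n

  sumTo : ℕ → (ℕ → Carrier) → Carrier
  sumTo zero    f = f zero
  sumTo (suc n) f = sumTo n f + f (suc n)

  oneS : PS
  oneS zero    = 1#
  oneS (suc n) = 0#

  _+S_ : PS → PS → PS
  (f +S g) n = f n + g n

  _-S_ : PS → PS → PS
  (f -S g) n = f n - g n

  _*S_ : PS → PS → PS
  (f *S g) n = sumTo n (λ i → f i * g (n ∸ i))

  powS : PS → ℕ → PS
  powS f zero    = oneS
  powS f (suc k) = f *S powS f k

  expT : Carrier → PS
  expT X n = ι (invFact n) * (X ^′ n)
    where
    _^′_ : Carrier → ℕ → Carrier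
    x ^′ zero  = 1#
    x ^′ suc m = x * (x ^′ m)

  -- X^μ := Σ_k (X-1)^k (μ choose k).  When X-1 has zero constant term
  -- (the only case used), (X-1)^k has no t^n term for k > n, so the
  -- t^n coefficient of this formal sum is the finite sum over k ≤ n.
  powμ : PS → CharZeroField.Carrier K → PS
  powμ X μ n = sumTo n (λ k → powS (X -S oneS) k n * ι (binom μ k))

module Submission where

-- Write X = 1 + W (W(0) = 0) for the cosh/sinh series, μ = 1/λ and Y = X^μ.  For every derivation δ
-- of the series ring for which δW commutes with the powers of W, the power rule X·δY = μ·δW·Y holds.
-- Under (i) all coefficients of X, and their commutators with B, are polynomials in A, and the
-- cosh/sinh recurrences give X′ = λAX + [B, X].  The power rule for d/dt and for [B, _], together
-- with cancellation of X, yields Y′ = AY + [B, Y], hence (Y e^{Bt})′ = (A + B) Y e^{Bt}; the solution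
-- of this linear equation with value 1 at t = 0 is unique, which gives (ii).  Conversely, the t²
-- coefficients of (ii) read (A + B)² = B² + 2AB + α + (1 − λ)A², which is (i).

open import Defs
open import Level using (_⊔_)
open import Data.Product using (_×_; _,_)
open import Data.Sum using (inj₁; inj₂)
open import Data.Nat using (ℕ; zero; suc; _∸_; z≤n; s≤s) renaming (_+_ to _+ℕ_; _≤_ to _≤ℕ_; _<_ to _<ℕ_)
import Data.Nat.Properties as ℕ
open import Relation.Nullary using (¬_)
import Relation.Binary.PropositionalEquality as ≡
open import Relation.Binary.Bundles using (Setoid)
open import Algebra.Morphism.Structures using (IsRingHomomorphism)
import Algebra.Properties.Ring as RingProperties
import Algebra.Solver.CommutativeMonoid as CommutativeMonoidSolver
import Relation.Binary.Reasoning.Setoid as SetoidReasoning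

module ScalarLemmas {c ℓ} (K : CharZeroField c ℓ) where
  open CharZeroField K
  open FieldOps K
  open RingProperties ring
  open SetoidReasoning setoid
  open CommutativeMonoidSolver *-commutativeMonoid using (solve; _⊕_; _⊜_)

  natR-+ : ∀ i j → natR cring (i +ℕ j) ≈ natR cring i + natR cring j
  natR-+ zero    j = sym (+-identityˡ _)
  natR-+ (suc i) j = trans (+-congˡ (natR-+ i j)) (sym (+-assoc _ _ _))

  natR-one : natR cring 1 ≈ 1#
  natR-one = +-identityʳ 1#

  natR-suc*recipSuc : ∀ n → natR cring (suc n) * recipSuc n ≈ 1#
  natR-suc*recipSuc n = inv-r (natR cring (suc n)) (charZero n)

  recipSuc-zero : recipSuc 0 ≈ 1#
  recipSuc-zero = trans (sym (*-identityˡ _)) (trans (*-congʳ (sym natR-one)) (natR-suc*recipSuc 0))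

  invFact-one : invFact 1 ≈ 1#
  invFact-one = trans (*-identityˡ _) recipSuc-zero

  invFact-two : invFact 2 ≈ half
  invFact-two = trans (*-congʳ invFact-one) (*-identityˡ _)

  half*two : half * (1# + 1#) ≈ 1#
  half*two = trans (*-comm _ _) (trans (*-congʳ (+-congˡ (sym natR-one))) (natR-suc*recipSuc 1))

  half+half : half + half ≈ 1#
  half+half = trans (sym (trans (distribˡ half 1# 1#) (+-cong (*-identityʳ _) (*-identityʳ _)))) half*two

  x*natR-one : ∀ {x y} → x * natR cring 1 ≈ y → x ≈ y
  x*natR-one {x} p = trans (sym (*-identityʳ x)) (trans (*-congˡ (sym natR-one)) p)

  x*natR-two : ∀ {x y} → x * natR cring 2 ≈ y → x ≈ y * half
  x*natR-two {x} p = trans (sym (*-identityʳ x))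
    (trans (*-congˡ (sym (natR-suc*recipSuc 1))) (trans (sym (*-assoc _ _ _)) (*-congʳ p)))

  module _ (μ : Carrier) where

    binom-zero : binom μ 0 ≈ 1#
    binom-zero = *-identityʳ 1#

    μ-natR-zero : μ - natR cring 0 ≈ μ
    μ-natR-zero = trans (+-congˡ -0#≈0#) (+-identityʳ μ)

    natR-suc*binom-suc : ∀ k → natR cring (suc k) * binom μ (suc k) ≈ (μ - natR cring k) * binom μ k
    natR-suc*binom-suc k = begin
      N * ((falling μ k * (μ - n)) * (invFact k * recipSuc k))
        ≈⟨ solve 5 (λ N f m i r → N ⊕ ((f ⊕ m) ⊕ (i ⊕ r)) ⊜ (m ⊕ (f ⊕ i)) ⊕ (N ⊕ r)) refl
             N (falling μ k) (μ - n) (invFact k) (recipSuc k) ⟩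
      ((μ - n) * binom μ k) * (N * recipSuc k) ≈⟨ *-congˡ (natR-suc*recipSuc k) ⟩
      ((μ - n) * binom μ k) * 1#               ≈⟨ *-identityʳ _ ⟩
      (μ - n) * binom μ k                      ∎
      where
      N = natR cring (suc k)
      n = natR cring k

    binom-one : binom μ 1 ≈ μ
    binom-one = trans (*-cong (trans (*-identityˡ _) μ-natR-zero) invFact-one) (*-identityʳ μ)

    binom-two : binom μ 2 ≈ (μ * (μ - 1#)) * half
    binom-two = *-cong (*-cong (trans (*-identityˡ _) μ-natR-zero) (+-congˡ (-‿cong natR-one))) invFact-two

    -- makes the sum in the power rule telescope
    natR*binom-step : ∀ k → natR cring (suc k) * binom μ (suc k) + natR cring (suc (suc k)) * binom μ (suc (suc k))
                            ≈ binom μ (suc k) * μ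
    natR*binom-step k = begin
      N * b + natR cring (suc (suc k)) * binom μ (suc (suc k)) ≈⟨ +-congˡ (natR-suc*binom-suc (suc k)) ⟩
      N * b + (μ - N) * b                      ≈⟨ sym (distribʳ b N (μ - N)) ⟩
      (N + (μ - N)) * b                        ≈⟨ *-congʳ (trans (+-comm N _) (trans (+-assoc μ _ N)
                                                    (trans (+-congˡ (-‿inverseˡ N)) (+-identityʳ μ)))) ⟩
      μ * b                                    ≈⟨ *-comm μ b ⟩
      b * μ                                    ∎
      where
      N = natR cring (suc k)
      b = binom μ (suc k)

  module _ (s : Carrier) where

    private
      derivative-core : ∀ n e → half * ((s * e) * (invFact n * recipSuc n)) * natR cring (suc n)
                                  ≈ s * (half * (e * invFact n))
      derivative-core n e = begin
        half * ((s * e) * (invFact n * recipSuc n)) * N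
          ≈⟨ solve 6 (λ h s e f r N → (h ⊕ ((s ⊕ e) ⊕ (f ⊕ r))) ⊕ N ⊜ (s ⊕ (h ⊕ (e ⊕ f))) ⊕ (N ⊕ r)) refl
               half s e (invFact n) (recipSuc n) N ⟩
        s * (half * (e * invFact n)) * (N * recipSuc n) ≈⟨ *-congˡ (natR-suc*recipSuc n) ⟩
        s * (half * (e * invFact n)) * 1#                ≈⟨ *-identityʳ _ ⟩
        s * (half * (e * invFact n))                     ∎
        where N = natR cring (suc n)

      -s*x : ∀ x → (- s) * x ≈ - (s * x)
      -s*x x = sym (-‿distribˡ-* s x)

    coshC-suc : ∀ n → coshC s (suc n) * natR cring (suc n) ≈ s * sinhC s n
    coshC-suc n = trans (*-congʳ (*-congˡ (*-congʳ s-difference))) (derivative-core n _)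
      where
      p = powK s n
      q = powK (- s) n
      s-difference : s * p + (- s) * q ≈ s * (p - q)
      s-difference = trans (+-congˡ (trans (-s*x q) (-‿distribʳ-* s q))) (sym (distribˡ s p (- q)))

    sinhC-suc : ∀ n → sinhC s (suc n) * natR cring (suc n) ≈ s * coshC s n
    sinhC-suc n = trans (*-congʳ (*-congˡ (*-congʳ s-sum))) (derivative-core n _)
      where
      p = powK s n
      q = powK (- s) n
      s-sum : s * p - (- s) * q ≈ s * (p + q)
      s-sum = trans (+-congˡ (trans (-‿cong (-s*x q)) (-‿involutive _))) (sym (distribˡ s p q))

    coshC-zero : coshC s 0 ≈ 1#
    coshC-zero = trans (*-congˡ (*-identityʳ _)) half*two

    sinhC-zero : sinhC s 0 ≈ 0#
    sinhC-zero = trans (*-congˡ (trans (*-identityʳ _) (-‿inverseʳ 1#))) (zeroʳ _)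

    coshC-one : coshC s 1 ≈ 0#
    coshC-one = x*natR-one (trans (coshC-suc 0) (trans (*-congˡ sinhC-zero) (zeroʳ s)))

    sinhC-one : sinhC s 1 ≈ s
    sinhC-one = x*natR-one (trans (sinhC-suc 0) (trans (*-congˡ coshC-zero) (*-identityʳ s)))

    coshC-two : coshC s 2 ≈ (s * s) * half
    coshC-two = x*natR-two (trans (coshC-suc 1) (*-congˡ sinhC-one))

    sinhC-two : sinhC s 2 ≈ 0#
    sinhC-two = trans (x*natR-two (trans (sinhC-suc 1) (trans (*-congˡ coshC-one) (zeroʳ s)))) (zeroˡ _)

module SumLemmas {c ℓ a ℓa} {K : CharZeroField c ℓ} (𝒜 : KAlgebra K a ℓa) where
  open KAlgebra 𝒜
  open Series 𝒜 using (sumTo)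
  open RingProperties ring
  open SetoidReasoning setoid

  +-interchange : ∀ x y z w → (x + y) + (z + w) ≈ (x + z) + (y + w)
  +-interchange x y z w = begin
    (x + y) + (z + w) ≈⟨ +-assoc x y (z + w) ⟩
    x + (y + (z + w)) ≈⟨ +-congˡ (sym (+-assoc y z w)) ⟩
    x + ((y + z) + w) ≈⟨ +-congˡ (+-congʳ (+-comm y z)) ⟩
    x + ((z + y) + w) ≈⟨ +-congˡ (+-assoc z y w) ⟩
    x + (z + (y + w)) ≈⟨ sym (+-assoc x z (y + w)) ⟩
    (x + z) + (y + w) ∎

  sumTo-congᵇ : ∀ n {f g : ℕ → Carrier} → (∀ i → i ≤ℕ n → f i ≈ g i) → sumTo n f ≈ sumTo n g
  sumTo-congᵇ zero    h = h 0 z≤n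
  sumTo-congᵇ (suc n) h = +-cong (sumTo-congᵇ n (λ i i≤n → h i (ℕ.m≤n⇒m≤1+n i≤n))) (h (suc n) ℕ.≤-refl)

  sumTo-cong : ∀ n {f g : ℕ → Carrier} → (∀ i → f i ≈ g i) → sumTo n f ≈ sumTo n g
  sumTo-cong n h = sumTo-congᵇ n (λ i _ → h i)

  sumTo-zero : ∀ n (f : ℕ → Carrier) → (∀ i → i ≤ℕ n → f i ≈ 0#) → sumTo n f ≈ 0#
  sumTo-zero n f h = trans (sumTo-congᵇ n h) (zeros n)
    where
    zeros : ∀ n → sumTo n (λ _ → 0#) ≈ 0#
    zeros zero    = refl
    zeros (suc n) = trans (+-identityʳ _) (zeros n)

  sumTo-+ : ∀ n (f g : ℕ → Carrier) → sumTo n (λ i → f i + g i) ≈ sumTo n f + sumTo n g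
  sumTo-+ zero    f g = refl
  sumTo-+ (suc n) f g = trans (+-congʳ (sumTo-+ n f g)) (+-interchange _ _ _ _)

  *-sumTo : ∀ n x (f : ℕ → Carrier) → x * sumTo n f ≈ sumTo n (λ i → x * f i)
  *-sumTo zero    x f = refl
  *-sumTo (suc n) x f = trans (distribˡ x _ _) (+-congʳ (*-sumTo n x f))

  sumTo-* : ∀ n x (f : ℕ → Carrier) → sumTo n f * x ≈ sumTo n (λ i → f i * x)
  sumTo-* zero    x f = refl
  sumTo-* (suc n) x f = trans (distribʳ x _ _) (+-congʳ (sumTo-* n x f))

  sumTo-suc : ∀ n (f : ℕ → Carrier) → sumTo (suc n) f ≈ f 0 + sumTo n (λ i → f (suc i))
  sumTo-suc zero    f = refl
  sumTo-suc (suc n) f = trans (+-congʳ (sumTo-suc n f)) (+-assoc _ _ _)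

  sumTo-reverse : ∀ n (f : ℕ → Carrier) → sumTo n f ≈ sumTo n (λ i → f (n ∸ i))
  sumTo-reverse zero    f = refl
  sumTo-reverse (suc n) f = begin
    sumTo n f + f (suc n)                 ≈⟨ +-congʳ (sumTo-reverse n f) ⟩
    sumTo n (λ i → f (n ∸ i)) + f (suc n) ≈⟨ +-comm _ _ ⟩
    f (suc n) + sumTo n (λ i → f (n ∸ i)) ≈⟨ sym (sumTo-suc n (λ i → f (suc n ∸ i))) ⟩
    sumTo (suc n) (λ i → f (suc n ∸ i))   ∎

  sumTo-triangle : ∀ n (g : ℕ → ℕ → Carrier) →
    sumTo n (λ i → sumTo i (λ j → g j i)) ≈ sumTo n (λ j → sumTo (n ∸ j) (λ k → g j (j +ℕ k)))
  sumTo-triangle zero    g = refl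
  sumTo-triangle (suc n) g = begin
    sumTo n (λ i → sumTo i (λ j → g j i)) + sumTo (suc n) (λ j → g j (suc n))
      ≈⟨ +-congʳ (sumTo-triangle n g) ⟩
    rows n + (sumTo n (λ j → g j (suc n)) + g (suc n) (suc n))
      ≈⟨ sym (+-assoc _ _ _) ⟩
    (rows n + sumTo n (λ j → g j (suc n))) + g (suc n) (suc n)
      ≈⟨ +-cong (sym (sumTo-+ n _ _)) (reflexive (≡.cong (g (suc n)) (≡.sym (ℕ.+-identityʳ (suc n))))) ⟩
    sumTo n (λ j → row n j + g j (suc n)) + g (suc n) (suc n +ℕ 0)
      ≈⟨ +-cong (sumTo-congᵇ n extend-row)
                (reflexive (≡.cong (λ m → sumTo m (λ k → g (suc n) (suc n +ℕ k))) (≡.sym (ℕ.n∸n≡0 n)))) ⟩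
    rows (suc n) ∎
    where
    row : ℕ → ℕ → Carrier
    row m j = sumTo (m ∸ j) (λ k → g j (j +ℕ k))
    rows : ℕ → Carrier
    rows m = sumTo m (row m)
    extend-row : ∀ j → j ≤ℕ n → row n j + g j (suc n) ≈ row (suc n) j
    extend-row j j≤n = reflexive (≡.trans
      (≡.cong (λ m → row n j + g j m) (≡.sym (≡.trans (ℕ.+-suc j (n ∸ j)) (≡.cong suc (ℕ.m+[n∸m]≡n j≤n)))))
      (≡.cong (λ m → sumTo m (λ k → g j (j +ℕ k))) (≡.sym (ℕ.+-∸-assoc 1 j≤n))))

module SeriesAlgebra {c ℓ a ℓa} {K : CharZeroField c ℓ} (𝒜 : KAlgebra K a ℓa) where
  open KAlgebra 𝒜
  open Series 𝒜
  open SumLemmas 𝒜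
  open RingProperties ring
  private module K = CharZeroField K
  open IsRingHomomorphism ι-hom public
    renaming (⟦⟧-cong to ι-cong; +-homo to ι-+; *-homo to ι-*; 1#-homo to ι-1; 0#-homo to ι-0; -‿homo to ι-‿)

  infixl 7 _·S_
  infixr 7 _⋆S_
  infix  4 _≋_

  _·S_ : PS → K.Carrier → PS
  (F ·S k) n = F n * ι k

  _⋆S_ : Carrier → PS → PS
  (x ⋆S F) n = x * F n

  zeroS : PS
  zeroS n = 0#

  -- multiplication by t
  tS : PS → PS
  tS F zero    = 0#
  tS F (suc n) = F n

  sumS : ℕ → (ℕ → PS) → PS
  sumS N G n = sumTo N (λ k → G k n)

  -- _≈PS_ unfolds to a Π-type, from which Agda cannot recover the two series; wrapping it restores inference.
  record _≋_ (F G : PS) : Set ℓa where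
    constructor ⟪_⟫
    field coeff : F ≈PS G
  open _≋_ public

  ≋-setoid : Setoid a ℓa
  ≋-setoid = record
    { Carrier = PS ; _≈_ = _≋_
    ; isEquivalence = record
      { refl  = ⟪ (λ n → refl) ⟫
      ; sym   = λ p → ⟪ (λ n → sym (coeff p n)) ⟫
      ; trans = λ p q → ⟪ (λ n → trans (coeff p n) (coeff q n)) ⟫ } }

  open Setoid ≋-setoid public using () renaming (refl to ≋-refl; sym to ≋-sym; trans to ≋-trans)
  module ≋-Reasoning = SetoidReasoning ≋-setoid

  +S-cong : ∀ {F F′ G G′} → F ≋ F′ → G ≋ G′ → F +S G ≋ F′ +S G′
  +S-cong p q = ⟪ (λ n → +-cong (coeff p n) (coeff q n)) ⟫

  *S-cong : ∀ {F F′ G G′} → F ≋ F′ → G ≋ G′ → F *S G ≋ F′ *S G′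
  *S-cong p q = ⟪ (λ n → sumTo-cong n (λ i → *-cong (coeff p i) (coeff q (n ∸ i)))) ⟫

  +S-congˡ : ∀ F {G G′} → G ≋ G′ → F +S G ≋ F +S G′
  +S-congˡ F = +S-cong (≋-refl {F})

  +S-congʳ : ∀ G {F F′} → F ≋ F′ → F +S G ≋ F′ +S G
  +S-congʳ G p = +S-cong p (≋-refl {G})

  *S-congˡ : ∀ F {G G′} → G ≋ G′ → F *S G ≋ F *S G′
  *S-congˡ F = *S-cong (≋-refl {F})

  *S-congʳ : ∀ G {F F′} → F ≋ F′ → F *S G ≋ F′ *S G
  *S-congʳ G p = *S-cong p (≋-refl {G})

  ·S-cong : ∀ {F G} k → F ≋ G → F ·S k ≋ G ·S k
  ·S-cong k p = ⟪ (λ n → *-congʳ (coeff p n)) ⟫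

  ·S-congˡ : ∀ F {k k′} → k K.≈ k′ → F ·S k ≋ F ·S k′
  ·S-congˡ F p = ⟪ (λ n → *-congˡ (ι-cong p)) ⟫

  tS-cong : ∀ {F G} → F ≋ G → tS F ≋ tS G
  tS-cong p = ⟪ (λ { zero → refl ; (suc n) → coeff p n }) ⟫

  +S-assoc : ∀ F G H → (F +S G) +S H ≋ F +S (G +S H)
  +S-assoc F G H = ⟪ (λ n → +-assoc _ _ _) ⟫

  *S-distribˡ : ∀ F G H → F *S (G +S H) ≋ (F *S G) +S (F *S H)
  *S-distribˡ F G H = ⟪ (λ n → trans (sumTo-cong n (λ i → distribˡ _ _ _)) (sumTo-+ n _ _)) ⟫

  *S-distribʳ : ∀ F G H → (G +S H) *S F ≋ (G *S F) +S (H *S F)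
  *S-distribʳ F G H = ⟪ (λ n → trans (sumTo-cong n (λ i → distribʳ _ _ _)) (sumTo-+ n _ _)) ⟫

  *S-zeroʳ : ∀ F → F *S zeroS ≋ zeroS
  *S-zeroʳ F = ⟪ (λ n → sumTo-zero n _ (λ i _ → zeroʳ _)) ⟫

  *S-assoc : ∀ F G H → (F *S G) *S H ≋ F *S (G *S H)
  *S-assoc F G H = ⟪ (λ n → begin
    sumTo n (λ i → sumTo i (λ j → F j * G (i ∸ j)) * H (n ∸ i))
      ≈⟨ sumTo-cong n (λ i → sumTo-* i _ _) ⟩
    sumTo n (λ i → sumTo i (λ j → F j * G (i ∸ j) * H (n ∸ i)))
      ≈⟨ sumTo-triangle n (λ j i → F j * G (i ∸ j) * H (n ∸ i)) ⟩
    sumTo n (λ j → sumTo (n ∸ j) (λ k → F j * G (j +ℕ k ∸ j) * H (n ∸ (j +ℕ k))))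
      ≈⟨ sumTo-cong n (λ j → sumTo-cong (n ∸ j) (λ k →
           trans (*-assoc _ _ _) (*-congˡ (*-cong (reflexive (≡.cong G (ℕ.m+n∸m≡n j k)))
                                                   (reflexive (≡.cong H (≡.sym (ℕ.∸-+-assoc n j k)))))))) ⟩
    sumTo n (λ j → sumTo (n ∸ j) (λ k → F j * (G k * H (n ∸ j ∸ k))))
      ≈⟨ sym (sumTo-cong n (λ j → *-sumTo (n ∸ j) _ _)) ⟩
    sumTo n (λ j → F j * sumTo (n ∸ j) (λ k → G k * H (n ∸ j ∸ k))) ∎) ⟫
    where open SetoidReasoning setoid

  *S-identityˡ : ∀ F → oneS *S F ≋ F
  *S-identityˡ F = ⟪ (λ { zero → *-identityˡ _ ; (suc n) → begin
    sumTo (suc n) (λ i → oneS i * F (suc n ∸ i))        ≈⟨ sumTo-suc n _ ⟩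
    1# * F (suc n) + sumTo n (λ i → 0# * F (n ∸ i))     ≈⟨ +-cong (*-identityˡ _) (sumTo-zero n _ (λ i _ → zeroˡ _)) ⟩
    F (suc n) + 0#                                      ≈⟨ +-identityʳ _ ⟩
    F (suc n)                                           ∎ }) ⟫
    where open SetoidReasoning setoid

  *S-comm : ∀ F G → (∀ i j → F i * G j ≈ G j * F i) → F *S G ≋ G *S F
  *S-comm F G F*G≈G*F = ⟪ (λ n → begin
    sumTo n (λ i → F i * G (n ∸ i))                     ≈⟨ sumTo-reverse n _ ⟩
    sumTo n (λ i → F (n ∸ i) * G (n ∸ (n ∸ i)))
      ≈⟨ sumTo-congᵇ n (λ i i≤n → trans (F*G≈G*F _ _) (*-congʳ (reflexive (≡.cong G (ℕ.m∸[m∸n]≡n i≤n))))) ⟩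
    sumTo n (λ i → G i * F (n ∸ i))                     ∎) ⟫
    where open SetoidReasoning setoid

  *S-identityʳ : ∀ F → F *S oneS ≋ F
  *S-identityʳ F = ≋-trans (*S-comm F oneS oneS-central) (*S-identityˡ F)
    where
    oneS-central : ∀ i j → F i * oneS j ≈ oneS j * F i
    oneS-central i zero    = trans (*-identityʳ _) (sym (*-identityˡ _))
    oneS-central i (suc j) = trans (zeroʳ _) (sym (zeroˡ _))

  *S-·S : ∀ F G k → (F *S G) ·S k ≋ F *S (G ·S k)
  *S-·S F G k = ⟪ (λ n → trans (sumTo-* n _ _) (sumTo-cong n (λ i → *-assoc _ _ _))) ⟫

  ·S-*S : ∀ F G k → (F ·S k) *S G ≋ (F *S G) ·S k
  ·S-*S F G k = ⟪ (λ n → trans (sumTo-cong n (λ i → trans (*-assoc _ _ _)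
    (trans (*-congˡ (ι-central k _)) (sym (*-assoc _ _ _))))) (sym (sumTo-* n _ _))) ⟫

  ·S-distrib : ∀ F a b → (F ·S a) +S (F ·S b) ≋ F ·S (a K.+ b)
  ·S-distrib F a b = ⟪ (λ n → trans (sym (distribˡ _ _ _)) (*-congˡ (sym (ι-+ a b)))) ⟫

  ·S-assoc : ∀ F a b → (F ·S a) ·S b ≋ F ·S (a K.* b)
  ·S-assoc F a b = ⟪ (λ n → trans (*-assoc _ _ _) (*-congˡ (sym (ι-* a b)))) ⟫

  ·S-identity : ∀ F → F ·S K.1# ≋ F
  ·S-identity F = ⟪ (λ n → trans (*-congˡ ι-1) (*-identityʳ _)) ⟫

  +S-·S : ∀ F G k → (F +S G) ·S k ≋ (F ·S k) +S (G ·S k)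
  +S-·S F G k = ⟪ (λ n → distribʳ _ _ _) ⟫

  ⋆S-*S : ∀ x F G → (x ⋆S F) *S G ≋ x ⋆S (F *S G)
  ⋆S-*S x F G = ⟪ (λ n → trans (sumTo-cong n (λ i → *-assoc _ _ _)) (sym (*-sumTo n _ _))) ⟫

  *S-⋆S : ∀ x F G → (∀ i → F i * x ≈ x * F i) → F *S (x ⋆S G) ≋ x ⋆S (F *S G)
  *S-⋆S x F G F*x≈x*F = ⟪ (λ n → trans (sumTo-cong n (λ i →
    trans (sym (*-assoc _ _ _)) (trans (*-congʳ (F*x≈x*F i)) (*-assoc _ _ _)))) (sym (*-sumTo n _ _))) ⟫

  ⋆S-distrib : ∀ x y F → (x ⋆S F) +S (y ⋆S F) ≋ (x + y) ⋆S F
  ⋆S-distrib x y F = ⟪ (λ n → sym (distribʳ _ _ _)) ⟫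

  tS-*S : ∀ F G → tS F *S G ≋ tS (F *S G)
  tS-*S F G = ⟪ (λ { zero → zeroˡ _
                   ; (suc n) → trans (sumTo-suc n _) (trans (+-congʳ (zeroˡ _)) (+-identityˡ _)) }) ⟫

  *S-tS : ∀ F G → F *S tS G ≋ tS (F *S G)
  *S-tS F G = ⟪ (λ { zero → zeroʳ _ ; (suc n) → begin
    sumTo n (λ i → F i * tS G (suc n ∸ i)) + F (suc n) * tS G (n ∸ n)
      ≈⟨ +-cong (sumTo-congᵇ n (λ i i≤n → *-congˡ (reflexive (≡.cong (tS G) (ℕ.+-∸-assoc 1 i≤n)))))
                (trans (*-congˡ (reflexive (≡.cong (tS G) (ℕ.n∸n≡0 n)))) (zeroʳ _)) ⟩
    sumTo n (λ i → F i * G (n ∸ i)) + 0#  ≈⟨ +-identityʳ _ ⟩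
    sumTo n (λ i → F i * G (n ∸ i))       ∎ }) ⟫
    where open SetoidReasoning setoid

  tS-·S : ∀ F k → tS F ·S k ≋ tS (F ·S k)
  tS-·S F k = ⟪ (λ { zero → zeroˡ _ ; (suc n) → refl }) ⟫

  tS-+S : ∀ F G → tS F +S tS G ≋ tS (F +S G)
  tS-+S F G = ⟪ (λ { zero → +-identityʳ 0# ; (suc n) → refl }) ⟫


  expT-zero : ∀ C → expT C 0 ≈ 1#
  expT-zero C = trans (*-congʳ ι-1) (*-identityˡ 1#)

  expT-one : ∀ C → expT C 1 ≈ C
  expT-one C = trans (*-cong (trans (ι-cong (ScalarLemmas.invFact-one K)) ι-1) (*-identityʳ C)) (*-identityˡ C)

  expT-two : ∀ C → expT C 2 ≈ ι (FieldOps.half K) * (C * C)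
  expT-two C = *-cong (ι-cong (ScalarLemmas.invFact-two K)) (*-congˡ (*-identityʳ C))

  powμ-zero : ∀ F μ → powμ F μ 0 ≈ 1#
  powμ-zero F μ = trans (*-identityˡ _) (trans (ι-cong (ScalarLemmas.binom-zero K μ)) ι-1)

  X*S-cancel : ∀ X {F G} → X 0 ≈ 1# → X *S F ≋ X *S G → F ≋ G
  X*S-cancel X {F} {G} X0≈1 X*F≈X*G = ⟪ (λ n → upTo n n ℕ.≤-refl) ⟫
    where
    X0*-cancel : ∀ {x y} → X 0 * x ≈ X 0 * y → x ≈ y
    X0*-cancel {x} {y} p = trans (sym (*-identityˡ x)) (trans (*-congʳ (sym X0≈1))
      (trans p (trans (*-congʳ X0≈1) (*-identityˡ y))))
    -- the tⁿ coefficient of X·F is X₀ Fₙ plus terms involving only F₀, …, Fₙ₋₁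
    upTo : ∀ n m → m ≤ℕ n → F m ≈ G m
    upTo n zero _ = X0*-cancel (coeff X*F≈X*G 0)
    upTo (suc n) (suc m) (s≤s m≤n) with ℕ.m≤n⇒m<n∨m≡n m≤n
    ... | inj₁ m<n = upTo n (suc m) m<n
    ... | inj₂ ≡.refl = X0*-cancel (+-cancelʳ _ _ _ (begin
      X 0 * F (suc m) + sumTo m (λ i → X (suc i) * F (m ∸ i)) ≈⟨ sym (sumTo-suc m _) ⟩
      (X *S F) (suc m)                                        ≈⟨ coeff X*F≈X*G (suc m) ⟩
      (X *S G) (suc m)                                        ≈⟨ sumTo-suc m _ ⟩
      X 0 * G (suc m) + sumTo m (λ i → X (suc i) * G (m ∸ i))
        ≈⟨ +-congˡ (sumTo-cong m (λ i → *-congˡ (sym (upTo m (m ∸ i) (ℕ.m∸n≤m m i))))) ⟩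
      X 0 * G (suc m) + sumTo m (λ i → X (suc i) * F (m ∸ i)) ∎))
      where open SetoidReasoning setoid

module GradedDerivations {c ℓ a ℓa} {K : CharZeroField c ℓ} (𝒜 : KAlgebra K a ℓa) where
  open KAlgebra 𝒜
  open Series 𝒜
  open SumLemmas 𝒜
  open SeriesAlgebra 𝒜
  open RingProperties ring
  open SetoidReasoning setoid
  private module K = CharZeroField K

  -- d n acts on the coefficient of tⁿ; the grading lets t·d/dt (d n x = n x) be a derivation alongside [B, _].
  record GradedDerivation : Set (c ⊔ a ⊔ ℓa) where
    field
      d         : ℕ → Carrier → Carrier
      d-cong    : ∀ n {x y} → x ≈ y → d n x ≈ d n y
      d-+       : ∀ n x y → d n (x + y) ≈ d n x + d n y
      d-leibniz : ∀ i j x y → d (i +ℕ j) (x * y) ≈ d i x * y + x * d j y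
      d-scalar  : ∀ k → d 0 (ι k) ≈ 0#

    δ : PS → PS
    δ F n = d n (F n)

    d-0# : ∀ n → d n 0# ≈ 0#
    d-0# n = x+x≈x⇒x≈0 _ (trans (sym (d-+ n 0# 0#)) (d-cong n (+-identityʳ 0#)))

    d-‿ : ∀ n x → d n (- x) ≈ - d n x
    d-‿ n x = +-inverseˡ-unique _ _ (trans (sym (d-+ n (- x) x)) (trans (d-cong n (-‿inverseˡ x)) (d-0# n)))

    d-sumTo : ∀ n m f → d n (sumTo m f) ≈ sumTo m (λ i → d n (f i))
    d-sumTo n zero    f = refl
    d-sumTo n (suc m) f = trans (d-+ n _ _) (+-congʳ (d-sumTo n m f))

    d-*ι : ∀ n x k → d n (x * ι k) ≈ d n x * ι k
    d-*ι n x k = begin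
      d n (x * ι k)               ≈⟨ reflexive (≡.cong (λ m → d m (x * ι k)) (≡.sym (ℕ.+-identityʳ n))) ⟩
      d (n +ℕ 0) (x * ι k)        ≈⟨ d-leibniz n 0 x (ι k) ⟩
      d n x * ι k + x * d 0 (ι k) ≈⟨ +-congˡ (trans (*-congˡ (d-scalar k)) (zeroʳ x)) ⟩
      d n x * ι k + 0#            ≈⟨ +-identityʳ _ ⟩
      d n x * ι k                 ∎

    d-oneS : ∀ n → d n (oneS n) ≈ 0#
    d-oneS zero    = trans (d-cong 0 (sym ι-1)) (d-scalar K.1#)
    d-oneS (suc n) = d-0# (suc n)

    δ-S-oneS : ∀ F → δ (F -S oneS) ≋ δ F
    δ-S-oneS F = ⟪ (λ n → trans (d-+ n _ _) (trans (+-congˡ (trans (d-‿ n _) (trans (-‿cong (d-oneS n)) -0#≈0#)))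
                                               (+-identityʳ _))) ⟫

    δ-oneS : δ oneS ≋ zeroS
    δ-oneS = ⟪ d-oneS ⟫

    δ-+S : ∀ F G → δ (F +S G) ≋ δ F +S δ G
    δ-+S F G = ⟪ (λ n → d-+ n _ _) ⟫

    δ-·S : ∀ F k → δ (F ·S k) ≋ δ F ·S k
    δ-·S F k = ⟪ (λ n → d-*ι n _ k) ⟫

    δ-*S : ∀ F G → δ (F *S G) ≋ (δ F *S G) +S (F *S δ G)
    δ-*S F G = ⟪ (λ n → begin
      d n (sumTo n (λ i → F i * G (n ∸ i)))  ≈⟨ d-sumTo n n _ ⟩
      sumTo n (λ i → d n (F i * G (n ∸ i)))
        ≈⟨ sumTo-congᵇ n (λ i i≤n → trans (reflexive (≡.cong (λ m → d m (F i * G (n ∸ i))) (≡.sym (ℕ.m+[n∸m]≡n i≤n))))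
                                          (d-leibniz i (n ∸ i) _ _)) ⟩
      sumTo n (λ i → d i (F i) * G (n ∸ i) + F i * d (n ∸ i) (G (n ∸ i))) ≈⟨ sumTo-+ n _ _ ⟩
      (δ F *S G) n + (F *S δ G) n            ∎) ⟫

  ad : Carrier → Carrier → Carrier
  ad B x = B * x - x * B

  adDerivation : Carrier → GradedDerivation
  adDerivation B = record
    { d         = λ _ → ad B
    ; d-cong    = λ _ x≈y → +-cong (*-congˡ x≈y) (-‿cong (*-congʳ x≈y))
    ; d-+       = λ _ x y → trans (+-cong (distribˡ B x y) (trans (-‿cong (distribʳ B x y)) (sym (-‿+-comm _ _))))
                                  (+-interchange _ _ _ _)
    ; d-leibniz = λ _ _ → ad-leibniz
    ; d-scalar  = λ k → trans (+-congˡ (-‿cong (ι-central k B))) (-‿inverseʳ _)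
    }
    where
    ad-leibniz : ∀ x y → ad B (x * y) ≈ ad B x * y + x * ad B y
    ad-leibniz x y = sym (begin
      (B * x - x * B) * y + x * (B * y - y * B)
        ≈⟨ +-cong (trans (distribʳ y _ _) (+-congˡ (sym (-‿distribˡ-* _ _))))
                  (trans (distribˡ x _ _) (+-congˡ (sym (-‿distribʳ-* _ _)))) ⟩
      (B * x * y - x * B * y) + (x * (B * y) - x * (y * B))
        ≈⟨ +-congˡ (+-congʳ (sym (*-assoc x B y))) ⟩
      (B * x * y - x * B * y) + (x * B * y - x * (y * B))
        ≈⟨ trans (+-assoc _ _ _) (+-congˡ (trans (sym (+-assoc _ _ _))
             (trans (+-congʳ (-‿inverseˡ _)) (+-identityˡ _)))) ⟩
      B * x * y - x * (y * B)
        ≈⟨ +-cong (*-assoc B x y) (-‿cong (sym (*-assoc x y B))) ⟩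
      B * (x * y) - x * y * B ∎)

  ad*S+*S⋆S : ∀ B F G → (GradedDerivation.δ (adDerivation B) F *S G) +S (F *S (B ⋆S G)) ≋ B ⋆S (F *S G)
  ad*S+*S⋆S B F G = ⟪ (λ n → trans (sym (sumTo-+ n _ _))
    (trans (sumTo-cong n (λ i → ad-absorb (F i) (G (n ∸ i)))) (sym (*-sumTo n B _)))) ⟫
    where
    ad-absorb : ∀ y e → ad B y * e + y * (B * e) ≈ B * (y * e)
    ad-absorb y e = begin
      (B * y - y * B) * e + y * (B * e)        ≈⟨ +-cong (trans (distribʳ e _ _) (+-congˡ (sym (-‿distribˡ-* _ _))))
                                                         (sym (*-assoc y B e)) ⟩
      (B * y * e + - (y * B * e)) + y * B * e  ≈⟨ trans (+-assoc _ _ _) (trans (+-congˡ (-‿inverseˡ _)) (+-identityʳ _)) ⟩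
      B * y * e                                ≈⟨ *-assoc _ _ _ ⟩
      B * (y * e)                              ∎

  natA : ℕ → Carrier
  natA n = ι (natR K.cring n)

  eulerDerivation : GradedDerivation
  eulerDerivation = record
    { d         = λ n x → x * natA n
    ; d-cong    = λ _ → *-congʳ
    ; d-+       = λ _ _ _ → distribʳ _ _ _
    ; d-leibniz = euler-leibniz
    ; d-scalar  = λ k → trans (*-congˡ ι-0) (zeroʳ _)
    }
    where
    euler-leibniz : ∀ i j x y → x * y * natA (i +ℕ j) ≈ x * natA i * y + x * (y * natA j)
    euler-leibniz i j x y = begin
      x * y * natA (i +ℕ j)                 ≈⟨ *-congˡ (trans (ι-cong (ScalarLemmas.natR-+ K i j)) (ι-+ _ _)) ⟩
      x * y * (natA i + natA j)             ≈⟨ distribˡ _ _ _ ⟩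
      x * y * natA i + x * y * natA j
        ≈⟨ +-cong (trans (*-assoc x y _) (trans (*-congˡ (sym (ι-central _ y))) (sym (*-assoc x _ y))))
                  (*-assoc x y _) ⟩
      x * natA i * y + x * (y * natA j)     ∎

module PowerRule {c ℓ a ℓa} {K : CharZeroField c ℓ} (𝒜 : KAlgebra K a ℓa) where
  open KAlgebra 𝒜
  open Series 𝒜
  open SumLemmas 𝒜
  open SeriesAlgebra 𝒜
  open GradedDerivations 𝒜
  open RingProperties ring
  private
    module K = CharZeroField K
    module KL = ScalarLemmas K
  open FieldOps K using (binom)

  module _ (D : GradedDerivation) (X : PS) (X0≈1 : X 0 ≈ 1#) (μ : K.Carrier) where
    open GradedDerivation D

    private
      W : PS
      W = X -S oneS

      P : ℕ → PS
      P = powS W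

      δW : PS
      δW = δ W

      partial : ℕ → PS
      partial N = sumS N (λ k → P k ·S binom μ k)

      γ : ℕ → K.Carrier
      γ j = natR K.cring (suc j) K.* binom μ (suc j)

      W0≈0 : W 0 ≈ 0#
      W0≈0 = trans (+-congʳ X0≈1) (-‿inverseʳ 1#)

      power-vanishes : ∀ k n → n <ℕ k → P k n ≈ 0#
      power-vanishes (suc k) n (s≤s n≤k) = sumTo-zero n _ (λ i i≤n → term n n≤k i i≤n)
        where
        term : ∀ n → n ≤ℕ k → ∀ i → i ≤ℕ n → W i * P k (n ∸ i) ≈ 0#
        term n _ zero _ = trans (*-congʳ W0≈0) (zeroˡ _)
        term (suc n) n<k (suc i) (s≤s i≤n) =
          trans (*-congˡ (power-vanishes k (n ∸ i) (ℕ.≤-<-trans (ℕ.m∸n≤m n i) n<k))) (zeroʳ _)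

      partial-agrees : ∀ N j → j ≤ℕ N → partial N j ≈ powμ X μ j
      partial-agrees zero zero z≤n = refl
      partial-agrees (suc N) j j≤N+1 with ℕ.m≤n⇒m<n∨m≡n j≤N+1
      ... | inj₂ ≡.refl = refl
      ... | inj₁ (s≤s j≤N) = trans (+-cong (partial-agrees N j j≤N)
              (trans (*-congʳ (power-vanishes (suc N) j (s≤s j≤N))) (zeroˡ _))) (+-identityʳ _)

      X*S-split : ∀ F → X *S F ≋ F +S (W *S F)
      X*S-split F = begin
        X *S F                  ≈⟨ *S-congʳ F X≈W+1 ⟩
        (W +S oneS) *S F        ≈⟨ *S-distribʳ F W oneS ⟩
        (W *S F) +S (oneS *S F) ≈⟨ +S-congˡ (W *S F) (*S-identityˡ F) ⟩
        (W *S F) +S F           ≈⟨ ⟪ (λ n → +-comm _ _) ⟫ ⟩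
        F +S (W *S F)           ∎
        where
        open ≋-Reasoning
        X≈W+1 : X ≋ W +S oneS
        X≈W+1 = ⟪ (λ n → sym (trans (+-assoc _ _ _) (trans (+-congˡ (-‿inverseˡ _)) (+-identityʳ _)))) ⟫

    module _ (δW-commutes : ∀ j → δW *S P j ≋ P j *S δW) where
      private
        δ-power : ∀ k → δ (P (suc k)) ≋ (P k *S δW) ·S natR K.cring (suc k)
        δ-power zero = begin
          δ (W *S oneS)                      ≈⟨ δ-*S W oneS ⟩
          (δW *S oneS) +S (W *S δ oneS)      ≈⟨ +S-cong (*S-identityʳ δW) (≋-trans (*S-congˡ W δ-oneS) (*S-zeroʳ W)) ⟩
          δW +S zeroS                        ≈⟨ ⟪ (λ n → +-identityʳ _) ⟫ ⟩
          δW                                 ≈⟨ ≋-sym (≋-trans (·S-cong _ (*S-identityˡ δW))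
                                                 (≋-trans (·S-congˡ δW KL.natR-one) (·S-identity δW))) ⟩
          (oneS *S δW) ·S natR K.cring 1     ∎
          where open ≋-Reasoning
        δ-power (suc k) = begin
          δ (W *S P (suc k))                                        ≈⟨ δ-*S W (P (suc k)) ⟩
          (δW *S P (suc k)) +S (W *S δ (P (suc k)))                 ≈⟨ +S-cong (δW-commutes (suc k)) (*S-congˡ W (δ-power k)) ⟩
          (P (suc k) *S δW) +S (W *S ((P k *S δW) ·S N))
            ≈⟨ +S-cong (≋-sym (·S-identity (P (suc k) *S δW))) (≋-trans (≋-sym (*S-·S W (P k *S δW) N)) (·S-cong N (≋-sym (*S-assoc W (P k) δW)))) ⟩
          ((P (suc k) *S δW) ·S K.1#) +S ((P (suc k) *S δW) ·S N)  ≈⟨ ·S-distrib _ K.1# N ⟩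
          (P (suc k) *S δW) ·S natR K.cring (suc (suc k))           ∎
          where
          open ≋-Reasoning
          N = natR K.cring (suc k)

        δ-partial-zero : δ (partial 0) ≋ zeroS
        δ-partial-zero = ≋-trans (δ-·S (P 0) _) (≋-trans (·S-cong _ δ-oneS) ⟪ (λ n → zeroˡ _) ⟫)

        δ-partial-suc : ∀ M → δ (partial (suc M)) ≋ δ (partial M) +S ((P M *S δW) ·S γ M)
        δ-partial-suc M = begin
          δ (partial M +S (P (suc M) ·S binom μ (suc M)))            ≈⟨ δ-+S _ _ ⟩
          δ (partial M) +S δ (P (suc M) ·S binom μ (suc M))
            ≈⟨ +S-congˡ (δ (partial M)) (≋-trans (δ-·S _ _) (·S-cong _ (δ-power M))) ⟩
          δ (partial M) +S (((P M *S δW) ·S natR K.cring (suc M)) ·S binom μ (suc M)) ≈⟨ +S-congˡ (δ (partial M)) (·S-assoc _ _ _) ⟩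
          δ (partial M) +S ((P M *S δW) ·S γ M)                      ∎
          where open ≋-Reasoning

        X*power*δW : ∀ j g → X *S ((P j *S δW) ·S g) ≋ ((P j *S δW) ·S g) +S ((P (suc j) *S δW) ·S g)
        X*power*δW j g = ≋-trans (X*S-split _) (+S-congˡ ((P j *S δW) ·S g)
          (≋-trans (≋-sym (*S-·S W (P j *S δW) g)) (·S-cong g (≋-sym (*S-assoc W (P j) δW)))))

        δW*partial-suc : ∀ M → δW *S partial (suc M) ≋ (δW *S partial M) +S ((P (suc M) *S δW) ·S binom μ (suc M))
        δW*partial-suc M = begin
          δW *S (partial M +S (P (suc M) ·S binom μ (suc M)))                   ≈⟨ *S-distribˡ δW (partial M) (P (suc M) ·S binom μ (suc M)) ⟩
          (δW *S partial M) +S (δW *S (P (suc M) ·S binom μ (suc M)))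
            ≈⟨ +S-congˡ (δW *S partial M) (≋-trans (≋-sym (*S-·S δW (P (suc M)) (binom μ (suc M)))) (·S-cong (binom μ (suc M)) (δW-commutes (suc M)))) ⟩
          (δW *S partial M) +S ((P (suc M) *S δW) ·S binom μ (suc M))          ∎
          where open ≋-Reasoning

        X*δpartial : ∀ M → X *S δ (partial (suc M)) ≋ ((δW *S partial M) ·S μ) +S ((P (suc M) *S δW) ·S γ M)
        X*δpartial zero = begin
          X *S δ (partial 1)                                      ≈⟨ *S-congˡ X (≋-trans (δ-partial-suc 0)
                                                                       (≋-trans (+S-congʳ ((P 0 *S δW) ·S γ 0) δ-partial-zero) ⟪ (λ n → +-identityˡ _) ⟫)) ⟩
          X *S ((P 0 *S δW) ·S γ 0)                               ≈⟨ X*power*δW 0 (γ 0) ⟩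
          ((P 0 *S δW) ·S γ 0) +S ((P 1 *S δW) ·S γ 0)           ≈⟨ +S-congʳ ((P 1 *S δW) ·S γ 0) first-term ⟩
          ((δW *S partial 0) ·S μ) +S ((P 1 *S δW) ·S γ 0)        ∎
          where
          open ≋-Reasoning
          γ0≈β0*μ : γ 0 K.≈ binom μ 0 K.* μ
          γ0≈β0*μ = K.trans (KL.natR-suc*binom-suc μ 0) (K.trans (K.*-congʳ (KL.μ-natR-zero μ)) (K.*-comm _ _))
          first-term : (P 0 *S δW) ·S γ 0 ≋ (δW *S partial 0) ·S μ
          first-term = begin
            (P 0 *S δW) ·S γ 0                 ≈⟨ ·S-congˡ _ γ0≈β0*μ ⟩
            (P 0 *S δW) ·S (binom μ 0 K.* μ)   ≈⟨ ≋-sym (·S-assoc _ _ _) ⟩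
            ((P 0 *S δW) ·S binom μ 0) ·S μ    ≈⟨ ·S-cong μ (·S-cong _ (≋-sym (δW-commutes 0))) ⟩
            ((δW *S P 0) ·S binom μ 0) ·S μ    ≈⟨ ·S-cong μ (*S-·S δW (P 0) _) ⟩
            (δW *S partial 0) ·S μ             ∎
        X*δpartial (suc M) = begin
          X *S δ (partial (suc (suc M)))
            ≈⟨ *S-congˡ X (δ-partial-suc (suc M)) ⟩
          X *S (δ (partial (suc M)) +S (Q ·S γ (suc M)))
            ≈⟨ *S-distribˡ X (δ (partial (suc M))) (Q ·S γ (suc M)) ⟩
          (X *S δ (partial (suc M))) +S (X *S (Q ·S γ (suc M)))
            ≈⟨ +S-cong (X*δpartial M) (X*power*δW (suc M) (γ (suc M))) ⟩
          (((δW *S partial M) ·S μ) +S (Q ·S γ M)) +S ((Q ·S γ (suc M)) +S boundary)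
            ≈⟨ ⟪ (λ n → regroup _ _ _ _) ⟫ ⟩
          (((δW *S partial M) ·S μ) +S ((Q ·S γ M) +S (Q ·S γ (suc M)))) +S boundary
            ≈⟨ +S-congʳ boundary (+S-congˡ ((δW *S partial M) ·S μ)
                 (≋-trans (·S-distrib Q _ _) (·S-congˡ Q (KL.natR*binom-step μ M)))) ⟩
          (((δW *S partial M) ·S μ) +S (Q ·S (binom μ (suc M) K.* μ))) +S boundary
            ≈⟨ +S-congʳ boundary (≋-sym (≋-trans (·S-cong μ (δW*partial-suc M))
                 (≋-trans (+S-·S _ _ μ) (+S-congˡ ((δW *S partial M) ·S μ) (·S-assoc Q _ μ))))) ⟩
          ((δW *S partial (suc M)) ·S μ) +S boundary ∎
          where
          open ≋-Reasoning
          Q = P (suc M) *S δW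
          boundary = (P (suc (suc M)) *S δW) ·S γ (suc M)
          regroup : ∀ x y z w → (x + y) + (z + w) ≈ (x + (y + z)) + w
          regroup x y z w = trans (+-assoc _ _ _) (trans (+-congˡ (sym (+-assoc _ _ _))) (sym (+-assoc _ _ _)))

      power-rule : X *S δ (powμ X μ) ≋ (δW *S powμ X μ) ·S μ
      power-rule = ⟪ (λ n → begin
        (X *S δ (powμ X μ)) n
          ≈⟨ sumTo-congᵇ n (λ i i≤n → *-congˡ (d-cong _ (sym (partial-agrees (suc n) (n ∸ i) (ℕ.m≤n⇒m≤1+n (ℕ.m∸n≤m n i)))))) ⟩
        (X *S δ (partial (suc n))) n
          ≈⟨ coeff (X*δpartial n) n ⟩
        ((δW *S partial n) ·S μ) n + ((P (suc n) *S δW) ·S γ n) n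
          ≈⟨ +-cong (*-congʳ (sumTo-congᵇ n (λ i i≤n → *-congˡ (partial-agrees n (n ∸ i) (ℕ.m∸n≤m n i)))))
                    (trans (*-congʳ (sumTo-zero n _ (λ i i≤n →
                      trans (*-congʳ (power-vanishes (suc n) i (s≤s i≤n))) (zeroˡ _)))) (zeroˡ _)) ⟩
        ((δW *S powμ X μ) ·S μ) n + 0#
          ≈⟨ +-identityʳ _ ⟩
        ((δW *S powμ X μ) ·S μ) n ∎) ⟫
        where open SetoidReasoning setoid

module Polynomials {c ℓ a ℓa} {K : CharZeroField c ℓ} (𝒜 : KAlgebra K a ℓa) (A : KAlgebra.Carrier 𝒜) where
  open KAlgebra 𝒜
  open Series 𝒜
  open SeriesAlgebra 𝒜
  open GradedDerivations 𝒜
  open RingProperties ring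
  private module K = CharZeroField K

  data IsPolynomial : Carrier → Set (c ⊔ a ⊔ ℓa) where
    poly-ι : ∀ k → IsPolynomial (ι k)
    poly-A : IsPolynomial A
    poly-+ : ∀ {x y} → IsPolynomial x → IsPolynomial y → IsPolynomial (x + y)
    poly-* : ∀ {x y} → IsPolynomial x → IsPolynomial y → IsPolynomial (x * y)
    poly-‿ : ∀ {x} → IsPolynomial x → IsPolynomial (- x)
    poly-≈ : ∀ {x y} → x ≈ y → IsPolynomial x → IsPolynomial y

  poly-commutes-with-A : ∀ {x} → IsPolynomial x → x * A ≈ A * x
  poly-commutes-with-A (poly-ι k) = ι-central k A
  poly-commutes-with-A poly-A = refl
  poly-commutes-with-A (poly-+ p q) =
    trans (distribʳ A _ _) (trans (+-cong (poly-commutes-with-A p) (poly-commutes-with-A q)) (sym (distribˡ A _ _)))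
  poly-commutes-with-A (poly-* {x} {y} p q) =
    trans (*-assoc x y A) (trans (*-congˡ (poly-commutes-with-A q)) (trans (sym (*-assoc x A y))
      (trans (*-congʳ (poly-commutes-with-A p)) (*-assoc A x y))))
  poly-commutes-with-A (poly-‿ {x} p) =
    trans (sym (-‿distribˡ-* x A)) (trans (-‿cong (poly-commutes-with-A p)) (-‿distribʳ-* A x))
  poly-commutes-with-A (poly-≈ x≈y p) = trans (*-congʳ (sym x≈y)) (trans (poly-commutes-with-A p) (*-congˡ x≈y))

  polys-commute : ∀ {x y} → IsPolynomial x → IsPolynomial y → x * y ≈ y * x
  polys-commute {x} px (poly-ι k) = sym (ι-central k x)
  polys-commute px poly-A = poly-commutes-with-A px
  polys-commute {x} px (poly-+ p q) =
    trans (distribˡ x _ _) (trans (+-cong (polys-commute px p) (polys-commute px q)) (sym (distribʳ x _ _)))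
  polys-commute {x} px (poly-* {y} {z} p q) =
    trans (sym (*-assoc x y z)) (trans (*-congʳ (polys-commute px p)) (trans (*-assoc y x z)
      (trans (*-congˡ (polys-commute px q)) (sym (*-assoc y z x)))))
  polys-commute {x} px (poly-‿ {y} p) =
    trans (sym (-‿distribʳ-* x y)) (trans (-‿cong (polys-commute px p)) (-‿distribˡ-* y x))
  polys-commute {x} px (poly-≈ y≈z p) = trans (*-congˡ (sym y≈z)) (trans (polys-commute px p) (*-congʳ y≈z))

  IsPolynomialSeries : PS → Set (c ⊔ a ⊔ ℓa)
  IsPolynomialSeries F = ∀ n → IsPolynomial (F n)

  poly-sumTo : ∀ n (f : ℕ → Carrier) → (∀ i → IsPolynomial (f i)) → IsPolynomial (sumTo n f)
  poly-sumTo zero    f h = h 0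
  poly-sumTo (suc n) f h = poly-+ (poly-sumTo n f h) (h (suc n))

  poly-*S : ∀ {F G} → IsPolynomialSeries F → IsPolynomialSeries G → IsPolynomialSeries (F *S G)
  poly-*S pF pG n = poly-sumTo n _ (λ i → poly-* (pF i) (pG (n ∸ i)))

  poly-oneS : IsPolynomialSeries oneS
  poly-oneS zero    = poly-≈ ι-1 (poly-ι K.1#)
  poly-oneS (suc n) = poly-≈ ι-0 (poly-ι K.0#)

  poly-powS : ∀ {F} → IsPolynomialSeries F → ∀ k → IsPolynomialSeries (powS F k)
  poly-powS pF zero    = poly-oneS
  poly-powS pF (suc k) = poly-*S pF (poly-powS pF k)

  polySeries-commute : ∀ {F G} → IsPolynomialSeries F → IsPolynomialSeries G → F *S G ≋ G *S F
  polySeries-commute pF pG = *S-comm _ _ (λ i j → polys-commute (pF i) (pG j))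

  module _ (B : Carrier) (ad-A : IsPolynomial (ad B A)) where
    open GradedDerivation (adDerivation B)

    ad-poly : ∀ {x} → IsPolynomial x → IsPolynomial (ad B x)
    ad-poly (poly-ι k)     = poly-≈ (sym (trans (d-scalar k) (sym ι-0))) (poly-ι K.0#)
    ad-poly poly-A         = ad-A
    ad-poly (poly-+ p q)   = poly-≈ (sym (d-+ 0 _ _)) (poly-+ (ad-poly p) (ad-poly q))
    ad-poly (poly-* p q)   = poly-≈ (sym (d-leibniz 0 0 _ _)) (poly-+ (poly-* (ad-poly p) q) (poly-* p (ad-poly q)))
    ad-poly (poly-‿ p)     = poly-≈ (sym (d-‿ 0 _)) (poly-‿ (ad-poly p))
    ad-poly (poly-≈ x≈y p) = poly-≈ (d-cong 0 x≈y) (ad-poly p)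

module EulerOperator {c ℓ a ℓa} {K : CharZeroField c ℓ} (𝒜 : KAlgebra K a ℓa) where
  open KAlgebra 𝒜
  open Series 𝒜
  open SeriesAlgebra 𝒜
  open GradedDerivations 𝒜
  open FieldOps K using (invFact; recipSuc)
  open SetoidReasoning setoid
  private
    module K = CharZeroField K
    module KL = ScalarLemmas K

  θ : PS → PS
  θ = GradedDerivation.δ eulerDerivation

  private
    natA*recipSuc : ∀ n → natA (suc n) * ι (recipSuc n) ≈ 1#
    natA*recipSuc n = trans (sym (ι-* _ _)) (trans (ι-cong (KL.natR-suc*recipSuc n)) ι-1)

  θ-expT : ∀ C → θ (expT C) ≋ tS (C ⋆S expT C)
  θ-expT C = ⟪ (λ { zero → trans (*-congˡ ι-0) (zeroʳ _) ; (suc n) → step n _ }) ⟫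
    where
    step : ∀ n Q → ι (invFact (suc n)) * (C * Q) * natA (suc n) ≈ C * (ι (invFact n) * Q)
    step n Q = begin
      ι (f K.* r) * (C * Q) * natA (suc n)   ≈⟨ *-assoc _ _ _ ⟩
      ι (f K.* r) * ((C * Q) * natA (suc n)) ≈⟨ *-congˡ (sym (ι-central _ _)) ⟩
      ι (f K.* r) * (natA (suc n) * (C * Q)) ≈⟨ sym (*-assoc _ _ _) ⟩
      ι (f K.* r) * natA (suc n) * (C * Q)   ≈⟨ *-congʳ (trans (*-congʳ (ι-* f r)) (trans (*-assoc _ _ _)
                                                 (trans (*-congˡ (trans (ι-central r _) (natA*recipSuc n))) (*-identityʳ _)))) ⟩
      ι f * (C * Q)                          ≈⟨ sym (*-assoc _ _ _) ⟩
      ι f * C * Q                            ≈⟨ *-congʳ (ι-central f C) ⟩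
      C * ι f * Q                            ≈⟨ *-assoc _ _ _ ⟩
      C * (ι f * Q)                          ∎
      where
      f = invFact n
      r = recipSuc n

  θ-unique : ∀ C {F G} → θ F ≋ tS (C ⋆S F) → θ G ≋ tS (C ⋆S G) → F 0 ≈ G 0 → F ≋ G
  θ-unique C {F} {G} θF θG F0≈G0 = ⟪ agree ⟫
    where
    divide : ∀ n x → x * natA (suc n) * ι (recipSuc n) ≈ x
    divide n x = trans (*-assoc _ _ _) (trans (*-congˡ (natA*recipSuc n)) (*-identityʳ x))
    agree : ∀ n → F n ≈ G n
    agree zero    = F0≈G0
    agree (suc n) = begin
      F (suc n)                                      ≈⟨ sym (divide n _) ⟩
      F (suc n) * natA (suc n) * ι (recipSuc n)      ≈⟨ *-congʳ (coeff θF (suc n)) ⟩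
      C * F n * ι (recipSuc n)                       ≈⟨ *-congʳ (*-congˡ (agree n)) ⟩
      C * G n * ι (recipSuc n)                       ≈⟨ *-congʳ (sym (coeff θG (suc n))) ⟩
      G (suc n) * natA (suc n) * ι (recipSuc n)      ≈⟨ divide n _ ⟩
      G (suc n)                                      ∎

module Corollary {c ℓ a ℓa} (K : CharZeroField c ℓ) (𝒜 : KAlgebra K a ℓa)
    (A B : KAlgebra.Carrier 𝒜) (α λ′ s : CharZeroField.Carrier K)
    (α≢0 : ¬ (CharZeroField._≈_ K α (CharZeroField.0# K)))
    (λ≢0 : ¬ (CharZeroField._≈_ K λ′ (CharZeroField.0# K)))
    (s² : CharZeroField._≈_ K (CharZeroField._*_ K s s) (CharZeroField._*_ K λ′ α)) where

  open KAlgebra 𝒜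
  open Series 𝒜
  open SumLemmas 𝒜
  open SeriesAlgebra 𝒜
  open GradedDerivations 𝒜
  open EulerOperator 𝒜
  open Polynomials 𝒜 A
  open RingProperties ring
  open FieldOps K using (coshC; sinhC; binom; half)
  private
    module K = CharZeroField K
    module KL = ScalarLemmas K

  μ : K.Carrier
  μ = K.inv λ′ λ≢0

  r : K.Carrier
  r = s K.* K.inv α α≢0

  X : PS
  X n = ι (coshC s n) + A * ι (r K.* sinhC s n)

  W Y : PS
  W = X -S oneS
  Y = powμ X μ

  r*s≈λ : r K.* s K.≈ λ′
  r*s≈λ = K.trans (K.*-assoc _ _ _) (K.trans (K.*-congˡ (K.*-comm _ _)) (K.trans (K.sym (K.*-assoc _ _ _))
           (K.trans (K.*-congʳ s²) (K.trans (K.*-assoc _ _ _) (K.trans (K.*-congˡ (K.inv-r α α≢0)) (K.*-identityʳ _))))))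

  α*r≈s : α K.* r K.≈ s
  α*r≈s = K.trans (K.sym (K.*-assoc _ _ _)) (K.trans (K.*-congʳ (K.*-comm _ _)) (K.trans (K.*-assoc _ _ _)
           (K.trans (K.*-congˡ (K.inv-r α α≢0)) (K.*-identityʳ _))))

  λ*μ≈1 : λ′ K.* μ K.≈ K.1#
  λ*μ≈1 = K.inv-r λ′ λ≢0

  X0≈1 : X 0 ≈ 1#
  X0≈1 = trans (+-cong (trans (ι-cong (KL.coshC-zero s)) ι-1)
                       (*-congˡ (trans (ι-cong (K.trans (K.*-congˡ (KL.sinhC-zero s)) (K.zeroʳ _))) ι-0)))
               (trans (+-congˡ (zeroʳ A)) (+-identityʳ 1#))

  poly-X : IsPolynomialSeries X
  poly-X n = poly-+ (poly-ι _) (poly-* poly-A (poly-ι _))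

  poly-W : IsPolynomialSeries W
  poly-W n = poly-+ (poly-X n) (poly-‿ (poly-oneS n))

  module Forward (commutator : ad B A ≈ ι α - ι λ′ * (A * A)) where
    private
      module adB = GradedDerivation (adDerivation B)
      module Euler = GradedDerivation eulerDerivation

    ad-X : ∀ n → ad B (X n) ≈ (ι α - ι λ′ * (A * A)) * ι (r K.* sinhC s n)
    ad-X n = begin
      ad B (ι (coshC s n) + A * ι k)          ≈⟨ adB.d-+ n _ _ ⟩
      ad B (ι (coshC s n)) + ad B (A * ι k)   ≈⟨ +-cong (adB.d-scalar _) (adB.d-*ι n A k) ⟩
      0# + ad B A * ι k                       ≈⟨ trans (+-identityˡ _) (*-congʳ commutator) ⟩
      (ι α - ι λ′ * (A * A)) * ι k            ∎
      where
      open SetoidReasoning setoid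
      k = r K.* sinhC s n

    X′-coeff : ∀ m → X (suc m) * natA (suc m) ≈ ι (s K.* sinhC s m) + A * ι (λ′ K.* coshC s m)
    X′-coeff m = begin
      (ι (coshC s (suc m)) + A * ι k′) * ι N     ≈⟨ distribʳ _ _ _ ⟩
      ι (coshC s (suc m)) * ι N + A * ι k′ * ι N ≈⟨ +-cong (sym (ι-* _ N)) (trans (*-assoc A _ _) (*-congˡ (sym (ι-* k′ N)))) ⟩
      ι (coshC s (suc m) K.* N) + A * ι (k′ K.* N) ≈⟨ +-cong (ι-cong (KL.coshC-suc s m)) (*-congˡ (ι-cong k′*N)) ⟩
      ι (s K.* sinhC s m) + A * ι (λ′ K.* coshC s m) ∎
      where
      open SetoidReasoning setoid
      N = natR K.cring (suc m)
      k′ = r K.* sinhC s (suc m)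
      k′*N : k′ K.* N K.≈ λ′ K.* coshC s m
      k′*N = K.trans (K.*-assoc _ _ _) (K.trans (K.*-congˡ (KL.sinhC-suc s m))
               (K.trans (K.sym (K.*-assoc _ _ _)) (K.*-congʳ r*s≈λ)))

    λAX+adX : ∀ m → A * X m * ι λ′ + ad B (X m) ≈ ι (s K.* sinhC s m) + A * ι (λ′ K.* coshC s m)
    λAX+adX m = begin
      A * X m * ι λ′ + ad B (X m)
        ≈⟨ +-cong (trans (*-congʳ (distribˡ A _ _)) (trans (distribʳ _ _ _) (+-cong λAC λAAk)))
                  (trans (ad-X m) (trans (distribʳ _ _ _) (+-congʳ αk))) ⟩
      (A * ι (λ′ K.* coshC s m) + T) + (ι (s K.* sinhC s m) + - (ι λ′ * (A * A)) * ι k)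
        ≈⟨ +-congˡ (+-congˡ (sym (-‿distribˡ-* _ _))) ⟩
      (A * ι (λ′ K.* coshC s m) + T) + (ι (s K.* sinhC s m) - T)
        ≈⟨ trans (+-interchange _ T _ (- T)) (trans (+-congˡ (-‿inverseʳ T)) (+-identityʳ _)) ⟩
      A * ι (λ′ K.* coshC s m) + ι (s K.* sinhC s m) ≈⟨ +-comm _ _ ⟩
      ι (s K.* sinhC s m) + A * ι (λ′ K.* coshC s m) ∎
      where
      open SetoidReasoning setoid
      k = r K.* sinhC s m
      T = ι λ′ * (A * A) * ι k
      λAC : A * ι (coshC s m) * ι λ′ ≈ A * ι (λ′ K.* coshC s m)
      λAC = trans (*-assoc _ _ _) (*-congˡ (trans (sym (ι-* _ λ′)) (ι-cong (K.*-comm _ _))))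
      λAAk : A * (A * ι k) * ι λ′ ≈ T
      λAAk = trans (sym (ι-central λ′ _)) (trans (*-congˡ (sym (*-assoc A A _))) (sym (*-assoc _ _ _)))
      αk : ι α * ι k ≈ ι (s K.* sinhC s m)
      αk = trans (sym (ι-* α k)) (ι-cong (K.trans (K.sym (K.*-assoc _ _ _)) (K.*-congʳ α*r≈s)))

    θ-W : θ W ≋ tS (((A ⋆S X) ·S λ′) +S adB.δ W)
    θ-W = ⟪ (λ { zero → trans (*-congˡ ι-0) (zeroʳ _) ; (suc m) → begin
      (X (suc m) + - 0#) * natA (suc m)  ≈⟨ *-congʳ (trans (+-congˡ -0#≈0#) (+-identityʳ _)) ⟩
      X (suc m) * natA (suc m)           ≈⟨ X′-coeff m ⟩
      ι (s K.* sinhC s m) + A * ι (λ′ K.* coshC s m) ≈⟨ sym (λAX+adX m) ⟩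
      A * X m * ι λ′ + ad B (X m)        ≈⟨ +-congˡ (sym (coeff (adB.δ-S-oneS X) m)) ⟩
      A * X m * ι λ′ + ad B (W m)        ∎ }) ⟫
      where open SetoidReasoning setoid

    private
      Z E : PS
      Z = (A ⋆S Y) +S adB.δ Y
      E = expT B

      ad-A : IsPolynomial (ad B A)
      ad-A = poly-≈ (sym commutator) (poly-+ (poly-ι α) (poly-‿ (poly-* (poly-ι λ′) (poly-* poly-A poly-A))))

      θW-commutes : ∀ j → θ W *S powS W j ≋ powS W j *S θ W
      θW-commutes j = polySeries-commute (λ n → poly-* (poly-W n) (poly-ι _)) (poly-powS poly-W j)

      adW-commutes : ∀ j → adB.δ W *S powS W j ≋ powS W j *S adB.δ W
      adW-commutes j = polySeries-commute (λ n → ad-poly B ad-A (poly-W n)) (poly-powS poly-W j)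

    θ-Y : θ Y ≋ tS Z
    θ-Y = X*S-cancel X X0≈1 (begin
      X *S θ Y
        ≈⟨ power-rule eulerDerivation X X0≈1 μ θW-commutes ⟩
      (θ W *S Y) ·S μ
        ≈⟨ ·S-cong μ (≋-trans (*S-congʳ Y θ-W) (tS-*S G Y)) ⟩
      tS (G *S Y) ·S μ
        ≈⟨ ≋-trans (tS-·S (G *S Y) μ) (tS-cong (≋-trans (·S-cong μ (*S-distribʳ Y _ _)) (+S-·S _ _ μ))) ⟩
      tS (((λAX *S Y) ·S μ) +S ((adB.δ W *S Y) ·S μ))
        ≈⟨ tS-cong (+S-cong λAX*Y*μ (≋-sym (power-rule (adDerivation B) X X0≈1 μ adW-commutes))) ⟩
      tS ((A ⋆S (X *S Y)) +S (X *S adB.δ Y))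
        ≈⟨ tS-cong (+S-congʳ (X *S adB.δ Y) (≋-sym (*S-⋆S A X Y (λ i → poly-commutes-with-A (poly-X i))))) ⟩
      tS ((X *S (A ⋆S Y)) +S (X *S adB.δ Y))
        ≈⟨ ≋-trans (tS-cong (≋-sym (*S-distribˡ X (A ⋆S Y) (adB.δ Y)))) (≋-sym (*S-tS X Z)) ⟩
      X *S tS Z ∎)
      where
      open ≋-Reasoning
      open PowerRule 𝒜
      λAX G : PS
      λAX = (A ⋆S X) ·S λ′
      G = λAX +S adB.δ W
      λAX*Y*μ : (λAX *S Y) ·S μ ≋ A ⋆S (X *S Y)
      λAX*Y*μ = begin
        (λAX *S Y) ·S μ                ≈⟨ ·S-cong μ (·S-*S (A ⋆S X) Y λ′) ⟩
        (((A ⋆S X) *S Y) ·S λ′) ·S μ   ≈⟨ ·S-assoc _ λ′ μ ⟩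
        ((A ⋆S X) *S Y) ·S (λ′ K.* μ)  ≈⟨ ·S-congˡ _ λ*μ≈1 ⟩
        ((A ⋆S X) *S Y) ·S K.1#        ≈⟨ ·S-identity _ ⟩
        (A ⋆S X) *S Y                  ≈⟨ ⋆S-*S A X Y ⟩
        A ⋆S (X *S Y)                  ∎

    θ-YE : θ (Y *S E) ≋ tS ((A + B) ⋆S (Y *S E))
    θ-YE = begin
      θ (Y *S E)                             ≈⟨ Euler.δ-*S Y E ⟩
      (θ Y *S E) +S (Y *S θ E)               ≈⟨ +S-cong (*S-congʳ E θ-Y) (*S-congˡ Y (θ-expT B)) ⟩
      (tS Z *S E) +S (Y *S tS (B ⋆S E))      ≈⟨ +S-cong (tS-*S Z E) (*S-tS Y (B ⋆S E)) ⟩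
      tS (Z *S E) +S tS (Y *S (B ⋆S E))      ≈⟨ tS-+S (Z *S E) (Y *S (B ⋆S E)) ⟩
      tS ((Z *S E) +S (Y *S (B ⋆S E)))       ≈⟨ tS-cong (+S-congʳ (Y *S (B ⋆S E)) (*S-distribʳ E (A ⋆S Y) (adB.δ Y))) ⟩
      tS ((((A ⋆S Y) *S E) +S (adB.δ Y *S E)) +S (Y *S (B ⋆S E)))
        ≈⟨ tS-cong (+S-assoc ((A ⋆S Y) *S E) (adB.δ Y *S E) (Y *S (B ⋆S E))) ⟩
      tS (((A ⋆S Y) *S E) +S ((adB.δ Y *S E) +S (Y *S (B ⋆S E))))
        ≈⟨ tS-cong (+S-cong (⋆S-*S A Y E) (ad*S+*S⋆S B Y E)) ⟩
      tS ((A ⋆S (Y *S E)) +S (B ⋆S (Y *S E)))  ≈⟨ tS-cong (⋆S-distrib A B (Y *S E)) ⟩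
      tS ((A + B) ⋆S (Y *S E))               ∎
      where open ≋-Reasoning

    forward : expT (A + B) ≈PS (Y *S E)
    forward = coeff (θ-unique (A + B) (θ-expT (A + B)) θ-YE
      (trans (expT-zero (A + B)) (sym (trans (*-cong (powμ-zero X μ) (expT-zero B)) (*-identityˡ 1#)))))

  module Backward (expansion : expT (A + B) ≈PS (Y *S expT B)) where
    private
      module KM = CommutativeMonoidSolver K.*-commutativeMonoid
      module AM = CommutativeMonoidSolver +-commutativeMonoid
      module KR = RingProperties K.ring
      h = half

      ιh-cancel : ∀ {x y} → ι h * x ≈ ι h * y → x ≈ y
      ιh-cancel {x} {y} p = trans (sym (two*half x)) (trans (*-congˡ p) (two*half y))
        where
        two*half : ∀ z → ι (natR K.cring 2) * (ι h * z) ≈ z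
        two*half z = trans (sym (*-assoc _ _ _))
          (trans (*-congʳ (trans (sym (ι-* _ _)) (trans (ι-cong (KL.natR-suc*recipSuc 1)) ι-1))) (*-identityˡ z))

      ιh*x+ιh*x : ∀ x → ι h * x + ι h * x ≈ x
      ιh*x+ιh*x x = trans (sym (distribʳ x _ _))
        (trans (*-congʳ (trans (sym (ι-+ h h)) (trans (ι-cong KL.half+half) ι-1))) (*-identityˡ x))

      W-one : W 1 ≈ A * ι λ′
      W-one = begin
        (ι (coshC s 1) + A * ι (r K.* sinhC s 1)) + - 0#  ≈⟨ trans (+-congˡ -0#≈0#) (+-identityʳ _) ⟩
        ι (coshC s 1) + A * ι (r K.* sinhC s 1)
          ≈⟨ +-cong (trans (ι-cong (KL.coshC-one s)) ι-0) (*-congˡ (ι-cong (K.trans (K.*-congˡ (KL.sinhC-one s)) r*s≈λ))) ⟩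
        0# + A * ι λ′                                    ≈⟨ +-identityˡ _ ⟩
        A * ι λ′                                         ∎
        where open SetoidReasoning setoid

      W-two : W 2 ≈ ι (λ′ K.* α K.* h)
      W-two = begin
        (ι (coshC s 2) + A * ι (r K.* sinhC s 2)) + - 0#  ≈⟨ trans (+-congˡ -0#≈0#) (+-identityʳ _) ⟩
        ι (coshC s 2) + A * ι (r K.* sinhC s 2)
          ≈⟨ +-cong (ι-cong (K.trans (KL.coshC-two s) (K.*-congʳ s²)))
                    (trans (*-congˡ (trans (ι-cong (K.trans (K.*-congˡ (KL.sinhC-two s)) (K.zeroʳ _))) ι-0)) (zeroʳ A)) ⟩
        ι (λ′ K.* α K.* h) + 0#                          ≈⟨ +-identityʳ _ ⟩
        ι (λ′ K.* α K.* h)                               ∎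
        where open SetoidReasoning setoid

      W-powS-one : ∀ n → powS W 1 n ≈ W n
      W-powS-one = coeff (*S-identityʳ W)

      W0≈0 : W 0 ≈ 0#
      W0≈0 = trans (+-congʳ X0≈1) (-‿inverseʳ 1#)

      Y-one : Y 1 ≈ A
      Y-one = begin
        0# * ι (binom μ 0) + powS W 1 1 * ι (binom μ 1) ≈⟨ trans (+-congʳ (zeroˡ _)) (+-identityˡ _) ⟩
        powS W 1 1 * ι (binom μ 1)                     ≈⟨ *-cong (trans (W-powS-one 1) W-one) (ι-cong (KL.binom-one μ)) ⟩
        A * ι λ′ * ι μ                                 ≈⟨ trans (*-assoc _ _ _) (*-congˡ (trans (sym (ι-* _ _)) (trans (ι-cong λ*μ≈1) ι-1))) ⟩
        A * 1#                                         ≈⟨ *-identityʳ A ⟩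
        A                                              ∎
        where open SetoidReasoning setoid

      Y-two : Y 2 ≈ ι (α K.* h) + A * A * ι ((K.1# K.- λ′) K.* h)
      Y-two = begin
        (0# * ι (binom μ 0) + powS W 1 2 * ι (binom μ 1)) + powS W 2 2 * ι (binom μ 2)
          ≈⟨ +-cong (trans (+-congʳ (zeroˡ _)) (trans (+-identityˡ _) (*-cong (trans (W-powS-one 2) W-two) (ι-cong (KL.binom-one μ)))))
                    (*-congʳ W²-two) ⟩
        ι (λ′ K.* α K.* h) * ι μ + A * ι λ′ * (A * ι λ′) * ι (binom μ 2)
          ≈⟨ +-cong (trans (sym (ι-* _ _)) (ι-cong λαh*μ)) (trans (Aλ*Aλ (binom μ 2)) (*-congˡ (ι-cong λλ*binom-two))) ⟩
        ι (α K.* h) + A * A * ι ((K.1# K.- λ′) K.* h) ∎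
        where
        open SetoidReasoning setoid
        W²-two : powS W 2 2 ≈ A * ι λ′ * (A * ι λ′)
        W²-two = begin
          (W 0 * powS W 1 2 + W 1 * powS W 1 1) + W 2 * powS W 1 0
            ≈⟨ +-cong (+-cong (trans (*-congʳ W0≈0) (zeroˡ _)) (*-cong W-one (trans (W-powS-one 1) W-one)))
                      (trans (*-congˡ (trans (W-powS-one 0) W0≈0)) (zeroʳ _)) ⟩
          (0# + A * ι λ′ * (A * ι λ′)) + 0#  ≈⟨ trans (+-identityʳ _) (+-identityˡ _) ⟩
          A * ι λ′ * (A * ι λ′)              ∎
        Aλ*Aλ : ∀ k → A * ι λ′ * (A * ι λ′) * ι k ≈ A * A * ι (λ′ K.* λ′ K.* k)
        Aλ*Aλ k = begin
          A * ι λ′ * (A * ι λ′) * ι k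
            ≈⟨ *-congʳ (trans (*-assoc _ _ _) (*-congˡ (trans (sym (*-assoc _ _ _)) (trans (*-congʳ (ι-central λ′ A)) (*-assoc _ _ _))))) ⟩
          A * (A * (ι λ′ * ι λ′)) * ι k  ≈⟨ trans (*-congʳ (sym (*-assoc _ _ _))) (*-assoc _ _ _) ⟩
          A * A * (ι λ′ * ι λ′ * ι k)    ≈⟨ *-congˡ (trans (*-congʳ (sym (ι-* _ _))) (sym (ι-* _ _))) ⟩
          A * A * ι (λ′ K.* λ′ K.* k)    ∎
        λαh*μ : (λ′ K.* α K.* h) K.* μ K.≈ α K.* h
        λαh*μ = K.trans (KM.solve 4 (λ l a hh m → ((l KM.⊕ a) KM.⊕ hh) KM.⊕ m KM.⊜ (l KM.⊕ m) KM.⊕ (a KM.⊕ hh)) K.refl λ′ α h μ)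
                        (K.trans (K.*-congʳ λ*μ≈1) (K.*-identityˡ _))
        λλ*binom-two : (λ′ K.* λ′) K.* binom μ 2 K.≈ (K.1# K.- λ′) K.* h
        λλ*binom-two = K.trans (K.*-congˡ (KL.binom-two μ)) (K.trans
          (KM.solve 4 (λ l m n hh → (l KM.⊕ l) KM.⊕ ((m KM.⊕ n) KM.⊕ hh) KM.⊜ ((l KM.⊕ m) KM.⊕ (l KM.⊕ n)) KM.⊕ hh)
            K.refl λ′ μ (μ K.- K.1#) h)
          (K.*-congʳ (K.trans (K.*-cong λ*μ≈1 (K.trans (K.distribˡ λ′ μ (K.- K.1#))
            (K.+-cong λ*μ≈1 (K.trans (K.sym (KR.-‿distribʳ-* λ′ K.1#)) (K.-‿cong (K.*-identityʳ λ′))))))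
            (K.*-identityˡ _))))

      -- the t² coefficient of the expansion, doubled
      square-expansion : (A + B) * (A + B) ≈ (B * B + (A * B + A * B)) + (ι α + A * A * ι (K.1# K.- λ′))
      square-expansion = ιh-cancel (begin
        ι h * ((A + B) * (A + B))   ≈⟨ sym (expT-two (A + B)) ⟩
        expT (A + B) 2              ≈⟨ expansion 2 ⟩
        (Y 0 * expT B 2 + Y 1 * expT B 1) + Y 2 * expT B 0
          ≈⟨ +-cong (+-cong (trans (*-cong (powμ-zero X μ) (expT-two B)) (*-identityˡ _)) (*-cong Y-one (expT-one B)))
                    (trans (*-cong Y-two (expT-zero B)) (*-identityʳ _)) ⟩
        (ι h * (B * B) + A * B) + (ι (α K.* h) + A * A * ι ((K.1# K.- λ′) K.* h))
          ≈⟨ +-cong (+-congˡ (trans (sym (ιh*x+ιh*x _)) (sym (distribˡ _ _ _))))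
                    (+-cong (trans (ι-cong (K.*-comm _ _)) (ι-* _ _))
                            (trans (*-congˡ (ι-* _ _)) (trans (sym (*-assoc _ _ _)) (sym (ι-central h _))))) ⟩
        (ι h * (B * B) + ι h * (A * B + A * B)) + (ι h * ι α + ι h * (A * A * ι (K.1# K.- λ′)))
          ≈⟨ trans (+-cong (sym (distribˡ _ _ _)) (sym (distribˡ _ _ _))) (sym (distribˡ _ _ _)) ⟩
        ι h * ((B * B + (A * B + A * B)) + (ι α + A * A * ι (K.1# K.- λ′))) ∎)
        where open SetoidReasoning setoid

    backward : ad B A ≈ ι α - ι λ′ * (A * A)
    backward = begin
      B * A + - (A * B)              ≈⟨ +-congʳ (+-cancelʳ Q _ _ BA+Q) ⟩
      ((ι α + f) + A * B) + - (A * B) ≈⟨ trans (+-assoc _ _ _) (trans (+-congˡ (-‿inverseʳ _)) (+-identityʳ _)) ⟩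
      ι α + f                         ∎
      where
      open SetoidReasoning setoid
      f = - (ι λ′ * (A * A))
      Q = (A * A + A * B) + B * B
      AA*[1-λ] : A * A * ι (K.1# K.- λ′) ≈ A * A + f
      AA*[1-λ] = trans (*-congˡ (trans (ι-+ _ _) (+-cong ι-1 (ι-‿ λ′)))) (trans (distribˡ _ _ _)
        (+-cong (*-identityʳ _) (trans (sym (-‿distribʳ-* _ _)) (-‿cong (sym (ι-central λ′ _))))))
      BA+Q : B * A + Q ≈ ((ι α + f) + A * B) + Q
      BA+Q = begin
        B * A + Q
          ≈⟨ AM.solve 4 (λ aa ab ba bb → ba AM.⊕ ((aa AM.⊕ ab) AM.⊕ bb) AM.⊜ (aa AM.⊕ ba) AM.⊕ (ab AM.⊕ bb))
               refl (A * A) (A * B) (B * A) (B * B) ⟩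
        (A * A + B * A) + (A * B + B * B)
          ≈⟨ sym (trans (distribˡ _ _ _) (+-cong (distribʳ _ _ _) (distribʳ _ _ _))) ⟩
        (A + B) * (A + B)
          ≈⟨ square-expansion ⟩
        (B * B + (A * B + A * B)) + (ι α + A * A * ι (K.1# K.- λ′))
          ≈⟨ +-congˡ (+-congˡ AA*[1-λ]) ⟩
        (B * B + (A * B + A * B)) + (ι α + (A * A + f))
          ≈⟨ AM.solve 5 (λ aa ab bb α′ f′ → (bb AM.⊕ (ab AM.⊕ ab)) AM.⊕ (α′ AM.⊕ (aa AM.⊕ f′))
                                              AM.⊜ ((α′ AM.⊕ f′) AM.⊕ ab) AM.⊕ ((aa AM.⊕ ab) AM.⊕ bb))
               refl (A * A) (A * B) (B * B) (ι α) f ⟩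
        ((ι α + f) + A * B) + Q ∎

corollary3p4 : ∀ {c ℓ a ℓa} (K : CharZeroField c ℓ) (𝒜 : KAlgebra K a ℓa)
    (A B : KAlgebra.Carrier 𝒜) (α λ′ s : CharZeroField.Carrier K)
    (α≢0 : ¬ (CharZeroField._≈_ K α (CharZeroField.0# K)))
    (λ≢0 : ¬ (CharZeroField._≈_ K λ′ (CharZeroField.0# K)))
    (s² : CharZeroField._≈_ K (CharZeroField._*_ K s s) (CharZeroField._*_ K λ′ α)) →
    let open KAlgebra 𝒜
        open Series 𝒜
        module K = CharZeroField K
        module F = FieldOps K
        X : PS
        X n = ι (F.coshC s n) + A * ι (s K.* K.inv α α≢0 K.* F.sinhC s n)
        cond-i = (B * A - A * B) ≈ (ι α - ι λ′ * (A * A))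
        cond-ii = expT (A + B) ≈PS (powμ X (K.inv λ′ λ≢0) *S expT B)
    in (cond-i → cond-ii) × (cond-ii → cond-i)
corollary3p4 K 𝒜 A B α λ′ s α≢0 λ≢0 s² =
  Forward.forward , Backward.backward
  where open Corollary K 𝒜 A B α λ′ s α≢0 λ≢0 s²
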